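{- For every integer $n\ge 2$ and every tanglegram $\mathcal{T}$ of size $n$, $$\operatorname{crt}(\mathcal{T})\le \frac{1}{2}\binom{n}{2}-\frac{n}{4}.$$ Equivalently, the maximum $M_n$ of $\operatorname{crt}(\mathcal{T})$ over all tanglegrams of size $n$ satisfies $M_n\le \frac12\binom{n}{2}-\frac n4$.
   Context: A rooted binary tree is a rooted tree in which every vertex has two children or none (leaves). A tanglegram $\mathcal{T}=(L,R,\sigma)$ consists of two rooted binary trees $L,R$ with the same number $n$ of leaves (its size) and a perfect matching $\sigma$ between their leaf sets. A layout is obtained by choosing at each internal vertex of $L$ and $R$ an order of its two children, which induces a top-to-bottom order of the leaves of $L$ on one vertical line and of the leaves of $R$ on a parallel line, the matching edges drawn as straight segments between the lines; two matching edges cross iff their endpoints appear in opposite relative orders on the two lines. The tanglegram crossing number $\operatorname{crt}(\mathcal{T})$ is the minimum number of crossing pairs of matching edges over all layouts of $\mathcal{T}$. -}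

module Defs where

open import Data.Nat using (ℕ; zero; suc; _+_; _*_; _∸_; _⊓_; _<ᵇ_)
open import Data.Bool using (Bool; true; false; _xor_; if_then_else_)
open import Data.Fin using (Fin; toℕ; splitAt)
open import Data.Fin.Permutation using (Permutation′; _⟨$⟩ʳ_)
open import Data.Sum using (inj₁; inj₂)
open import Data.List using (List; []; _∷_; map; concatMap; foldr; allFin; cartesianProduct)
open import Data.Nat.ListAction using (sum)
open import Data.Product using (_×_; _,_)

-- Leaves of a tree with n leaves are identified with Fin n, numbered
-- left-to-right in the (fixed, reference) child order of the constructor.
data Tree : ℕ → Set where
  leaf : Tree 1
  node : ∀ {a b} → Tree a → Tree b → Tree (a + b)

record Tanglegram (n : ℕ) : Set where
  constructor tanglegram
  field
    L : Tree n
    R : Tree n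
    σ : Permutation′ n

-- A layout of one tree: at every internal vertex, a choice of child order
-- (false = reference order, true = swapped).
data Flips : ∀ {n} → Tree n → Set where
  fleaf : Flips leaf
  fnode : ∀ {a b} {l : Tree a} {r : Tree b} →
          Bool → Flips l → Flips r → Flips (node l r)

allFlips : ∀ {n} (t : Tree n) → List (Flips t)
allFlips leaf = fleaf ∷ []
allFlips (node l r) =
  concatMap (λ c → concatMap (λ fl → map (λ fr → fnode c fl fr) (allFlips r)) (allFlips l))
            (true ∷ false ∷ [])

-- top-to-bottom position (0-based) of a leaf in the given layout
pos : ∀ {n} {t : Tree n} → Flips t → Fin n → ℕ
pos fleaf _ = 0
pos (fnode {a} {b} false fl fr) i with splitAt a i
... | inj₁ j = pos fl j
... | inj₂ k = a + pos fr k
pos (fnode {a} {b} true fl fr) i with splitAt a i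
... | inj₁ j = b + pos fl j
... | inj₂ k = pos fr k

crosses : ∀ {n} (T : Tanglegram n) → Flips (Tanglegram.L T) → Flips (Tanglegram.R T) →
          Fin n → Fin n → Bool
crosses T fL fR i j =
  (pos fL i <ᵇ pos fL j) xor (pos fR (σ ⟨$⟩ʳ i) <ᵇ pos fR (σ ⟨$⟩ʳ j))
  where open Tanglegram T

crossings : ∀ {n} (T : Tanglegram n) → Flips (Tanglegram.L T) → Flips (Tanglegram.R T) → ℕ
crossings {n} T fL fR =
  sum (concatMap (λ i → map (λ j →
        if toℕ i <ᵇ toℕ j then (if crosses T fL fR i j then 1 else 0) else 0)
      (allFin n)) (allFin n))

-- minimum of a list (every list used below is nonempty)
minimum : List ℕ → ℕ
minimum [] = 0
minimum (x ∷ xs) = foldr _⊓_ x xs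

crt : ∀ {n} → Tanglegram n → ℕ
crt T = minimum (map (λ p → crossings T (proj₁' p) (proj₂' p))
                     (cartesianProduct (allFlips (Tanglegram.L T)) (allFlips (Tanglegram.R T))))
  where
  proj₁' : ∀ {A B : Set} → A × B → A
  proj₁' (x , _) = x
  proj₂' : ∀ {A B : Set} → A × B → B
  proj₂' (_ , y) = y

module Submission where

-- Fix a layout of R and let q give the positions of the partners of the leaves of L. At an
-- internal node of L with a and b leaves below its two children, each of the a·b pairs split
-- there is either ordered or inverted by q, and the orientation of the node decides which of
-- the two classes cross. Choosing the smaller class at every node gives
-- 2·cr + Σ_v ∣ord_v − inv_v∣ ≤ C(n,2). For two disjoint nonempty sets of leaves of R, the
-- number of pairs drawn in order minus the number drawn out of order has average absolute
-- value at least 1 over all layouts of R: descend in R while both sets meet a common subtree;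
-- at a node separating them, flipping it exchanges the contributions p and q of the two
-- crossed blocks, so the two orientations give values whose sum is at least 2∣p − q∣ ≥ 2.
-- Hence the n − 1 internal nodes of L have average total imbalance at least n − 1, some
-- layout of R attains it, and 4·crt ≤ 2·C(n,2) − 2(n − 1) ≤ n(n − 1) − n.

open import Defs
open import Data.Bool using (Bool; true; false; not; _xor_; if_then_else_)
open import Data.Empty using (⊥-elim)
open import Data.Fin using (Fin; zero; suc; toℕ; splitAt; _↑ˡ_; _↑ʳ_)
open import Data.Fin.Permutation using (_⟨$⟩ʳ_; _⟨$⟩ˡ_; inverseˡ)
open import Data.Fin.Properties
  using (splitAt-↑ˡ; splitAt-↑ʳ; splitAt⁻¹-↑ˡ; splitAt⁻¹-↑ʳ; toℕ-↑ˡ; toℕ-↑ʳ; toℕ<n; ↑ˡ-injective; ↑ʳ-injective)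
open import Data.List using (List; []; _∷_; _++_; map; concatMap; allFin; tabulate; length; foldr)
open import Data.List.Membership.Propositional using (_∈_; lose)
open import Data.List.Membership.Propositional.Properties
  using (∈-map⁺; ∈-concatMap⁺; ∈-tabulate⁻; ∈-cartesianProduct⁺; ∈-length)
open import Data.List.Properties using (length-tabulate)
open import Data.List.Relation.Binary.Disjoint.Propositional using (Disjoint)
open import Data.List.Relation.Unary.Any using (here; there)
open import Data.Nat using (ℕ; zero; suc; _+_; _*_; _∸_; _≤_; _<_; _<ᵇ_; z≤n; s≤s; ∣_-_∣; _⊓_; _≤?_)
open import Data.Nat.ListAction using (sum)
open import Data.Nat.Properties
open import Algebra.Properties.CommutativeMonoid.Sum +-0-commutativeMonoid using (sum-syntax; sum-cong-≗; ∑-distrib-+)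
open import Data.Nat.Tactic.RingSolver using (solve-∀)
open import Data.Product using (Σ; _×_; _,_)
open import Data.Sum using (_⊎_; inj₁; inj₂)
open import Function using (_∘_)
open import Function.Definitions using (Injective)
open import Relation.Binary.PropositionalEquality
open import Relation.Nullary using (yes; no)

sumOver : ∀ {A : Set} → List A → (A → ℕ) → ℕ
sumOver []       f = 0
sumOver (x ∷ xs) f = f x + sumOver xs f

infixl 10 sumOver
syntax sumOver xs (λ x → e) = ∑[ x ∈ xs ] e

module _ {A : Set} where

  sumOver-cong : ∀ (xs : List A) {f g : A → ℕ} → (∀ x → f x ≡ g x) → ∑[ x ∈ xs ] f x ≡ ∑[ x ∈ xs ] g x
  sumOver-cong []       f≗g = refl
  sumOver-cong (x ∷ xs) f≗g = cong₂ _+_ (f≗g x) (sumOver-cong xs f≗g)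

  sumOver-mono-≤ : ∀ (xs : List A) {f g : A → ℕ} → (∀ x → f x ≤ g x) → ∑[ x ∈ xs ] f x ≤ ∑[ x ∈ xs ] g x
  sumOver-mono-≤ []       f≤g = z≤n
  sumOver-mono-≤ (x ∷ xs) f≤g = +-mono-≤ (f≤g x) (sumOver-mono-≤ xs f≤g)

  sumOver-distrib-+ : ∀ (xs : List A) (f g : A → ℕ) →
                      ∑[ x ∈ xs ] (f x + g x) ≡ ∑[ x ∈ xs ] f x + ∑[ x ∈ xs ] g x
  sumOver-distrib-+ []       f g = refl
  sumOver-distrib-+ (x ∷ xs) f g = begin
    f x + g x + ∑[ x ∈ xs ] (f x + g x)              ≡⟨ cong (f x + g x +_) (sumOver-distrib-+ xs f g) ⟩
    f x + g x + (∑[ x ∈ xs ] f x + ∑[ x ∈ xs ] g x)  ≡⟨ +-+-interchange (f x) (g x) _ _ ⟩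
    f x + ∑[ x ∈ xs ] f x + (g x + ∑[ x ∈ xs ] g x)  ∎
    where
    open ≡-Reasoning
    +-+-interchange : ∀ a b c d → a + b + (c + d) ≡ a + c + (b + d)
    +-+-interchange = solve-∀

  sumOver-const : ∀ (xs : List A) c → ∑[ x ∈ xs ] c ≡ length xs * c
  sumOver-const []       c = refl
  sumOver-const (x ∷ xs) c = cong (c +_) (sumOver-const xs c)

  length≡sumOver-1 : ∀ (xs : List A) → length xs ≡ ∑[ x ∈ xs ] 1
  length≡sumOver-1 xs = sym (trans (sumOver-const xs 1) (*-identityʳ (length xs)))

  sumOver-++ : ∀ (xs ys : List A) (f : A → ℕ) → ∑[ x ∈ xs ++ ys ] f x ≡ ∑[ x ∈ xs ] f x + ∑[ x ∈ ys ] f x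
  sumOver-++ []       ys f = refl
  sumOver-++ (x ∷ xs) ys f = trans (cong (f x +_) (sumOver-++ xs ys f)) (sym (+-assoc (f x) _ _))

module _ {A B : Set} where

  sumOver-map : ∀ (g : A → B) (xs : List A) (f : B → ℕ) → ∑[ y ∈ map g xs ] f y ≡ ∑[ x ∈ xs ] f (g x)
  sumOver-map g []       f = refl
  sumOver-map g (x ∷ xs) f = cong (f (g x) +_) (sumOver-map g xs f)

  sumOver-concatMap : ∀ (g : A → List B) (xs : List A) (f : B → ℕ) →
                      ∑[ y ∈ concatMap g xs ] f y ≡ ∑[ x ∈ xs ] ∑[ y ∈ g x ] f y
  sumOver-concatMap g []       f = refl
  sumOver-concatMap g (x ∷ xs) f =
    trans (sumOver-++ (g x) (concatMap g xs) f) (cong (∑[ y ∈ g x ] f y +_) (sumOver-concatMap g xs f))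

  sumOver-comm : ∀ (xs : List A) (ys : List B) (f : A → B → ℕ) →
                 ∑[ x ∈ xs ] ∑[ y ∈ ys ] f x y ≡ ∑[ y ∈ ys ] ∑[ x ∈ xs ] f x y
  sumOver-comm []       ys f = sym (trans (sumOver-const ys 0) (*-zeroʳ (length ys)))
  sumOver-comm (x ∷ xs) ys f =
    trans (cong (∑[ y ∈ ys ] f x y +_) (sumOver-comm xs ys f))
          (sym (sumOver-distrib-+ ys (f x) (λ y → ∑[ x ∈ xs ] f x y)))

sumOver-tabulate : ∀ {A : Set} n (g : Fin n → A) (f : A → ℕ) → ∑[ x ∈ tabulate g ] f x ≡ ∑[ i < n ] f (g i)
sumOver-tabulate zero    g f = refl
sumOver-tabulate (suc n) g f = cong (f (g zero) +_) (sumOver-tabulate n (g ∘ suc) f)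

∑-const : ∀ n c → ∑[ i < n ] c ≡ n * c
∑-const zero    c = refl
∑-const (suc n) c = cong (c +_) (∑-const n c)

∑-split : ∀ a b (f : Fin (a + b) → ℕ) → ∑[ i < a + b ] f i ≡ ∑[ i < a ] f (i ↑ˡ b) + ∑[ j < b ] f (a ↑ʳ j)
∑-split zero    b f = refl
∑-split (suc a) b f = trans (cong (f zero +_) (∑-split a b (f ∘ suc))) (sym (+-assoc (f zero) _ _))

pos-↑ˡ : ∀ {a b} {l : Tree a} {r : Tree b} c (fl : Flips l) (fr : Flips r) (i : Fin a) →
         pos (fnode c fl fr) (i ↑ˡ b) ≡ (if c then b + pos fl i else pos fl i)
pos-↑ˡ {a} {b} false fl fr i rewrite splitAt-↑ˡ a i b = refl
pos-↑ˡ {a} {b} true  fl fr i rewrite splitAt-↑ˡ a i b = refl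

pos-↑ʳ : ∀ {a b} {l : Tree a} {r : Tree b} c (fl : Flips l) (fr : Flips r) (j : Fin b) →
         pos (fnode c fl fr) (a ↑ʳ j) ≡ (if c then pos fr j else a + pos fr j)
pos-↑ʳ {a} {b} false fl fr j rewrite splitAt-↑ʳ a b j = refl
pos-↑ʳ {a} {b} true  fl fr j rewrite splitAt-↑ʳ a b j = refl

pos<n : ∀ {n} {t : Tree n} (f : Flips t) i → pos f i < n
pos<n fleaf i = s≤s z≤n
pos<n (fnode {a} {b} false fl fr) i with splitAt a i
... | inj₁ j = ≤-trans (pos<n fl j) (m≤m+n a b)
... | inj₂ k = +-monoʳ-< a (pos<n fr k)
pos<n (fnode {a} {b} true fl fr) i with splitAt a i
... | inj₁ j = subst (b + pos fl j <_) (+-comm b a) (+-monoʳ-< b (pos<n fl j))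
... | inj₂ k = ≤-trans (pos<n fr k) (m≤n+m b a)

+-cancelˡ-<ᵇ : ∀ a x y → (a + x <ᵇ a + y) ≡ (x <ᵇ y)
+-cancelˡ-<ᵇ zero    x y = refl
+-cancelˡ-<ᵇ (suc a) x y = +-cancelˡ-<ᵇ a x y

<⇒<ᵇ≡true : ∀ {x y} → x < y → (x <ᵇ y) ≡ true
<⇒<ᵇ≡true {zero}  {suc y} _         = refl
<⇒<ᵇ≡true {suc x} {suc y} (s≤s x<y) = <⇒<ᵇ≡true x<y

≤⇒<ᵇ≡false : ∀ {x y} → y ≤ x → (x <ᵇ y) ≡ false
≤⇒<ᵇ≡false {x}     {zero}  _         = refl
≤⇒<ᵇ≡false {suc x} {suc y} (s≤s y≤x) = ≤⇒<ᵇ≡false y≤x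

above : ∀ {m} {t : Tree m} → Flips t → Fin m → Fin m → Bool
above f i j = pos f i <ᵇ pos f j

module _ {a b} {l : Tree a} {r : Tree b} (fl : Flips l) (fr : Flips r) where

  above-↑ˡ-↑ˡ : ∀ c i j → above (fnode c fl fr) (i ↑ˡ b) (j ↑ˡ b) ≡ above fl i j
  above-↑ˡ-↑ˡ false i j rewrite pos-↑ˡ false fl fr i | pos-↑ˡ false fl fr j = refl
  above-↑ˡ-↑ˡ true  i j rewrite pos-↑ˡ true  fl fr i | pos-↑ˡ true  fl fr j = +-cancelˡ-<ᵇ b _ _

  above-↑ʳ-↑ʳ : ∀ c i j → above (fnode c fl fr) (a ↑ʳ i) (a ↑ʳ j) ≡ above fr i j
  above-↑ʳ-↑ʳ false i j rewrite pos-↑ʳ false fl fr i | pos-↑ʳ false fl fr j = +-cancelˡ-<ᵇ a _ _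
  above-↑ʳ-↑ʳ true  i j rewrite pos-↑ʳ true  fl fr i | pos-↑ʳ true  fl fr j = refl

  above-↑ˡ-↑ʳ : ∀ c i j → above (fnode c fl fr) (i ↑ˡ b) (a ↑ʳ j) ≡ not c
  above-↑ˡ-↑ʳ false i j rewrite pos-↑ˡ false fl fr i | pos-↑ʳ false fl fr j =
    <⇒<ᵇ≡true (≤-trans (pos<n fl i) (m≤m+n a _))
  above-↑ˡ-↑ʳ true  i j rewrite pos-↑ˡ true  fl fr i | pos-↑ʳ true  fl fr j =
    ≤⇒<ᵇ≡false (≤-trans (<⇒≤ (pos<n fr j)) (m≤m+n b _))

  above-↑ʳ-↑ˡ : ∀ c i j → above (fnode c fl fr) (a ↑ʳ i) (j ↑ˡ b) ≡ c
  above-↑ʳ-↑ˡ false i j rewrite pos-↑ʳ false fl fr i | pos-↑ˡ false fl fr j =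
    ≤⇒<ᵇ≡false (≤-trans (<⇒≤ (pos<n fl j)) (m≤m+n a _))
  above-↑ʳ-↑ˡ true  i j rewrite pos-↑ʳ true  fl fr i | pos-↑ˡ true  fl fr j =
    <⇒<ᵇ≡true (≤-trans (pos<n fr i) (m≤m+n b _))

module _ (a : ℕ) {b : ℕ} where

  lefts : List (Fin (a + b)) → List (Fin a)
  lefts []       = []
  lefts (x ∷ xs) with splitAt a x
  ... | inj₁ i = i ∷ lefts xs
  ... | inj₂ _ = lefts xs

  rights : List (Fin (a + b)) → List (Fin b)
  rights []       = []
  rights (x ∷ xs) with splitAt a x
  ... | inj₁ _ = rights xs
  ... | inj₂ j = j ∷ rights xs

  sumOver-lefts-rights : ∀ xs (f : Fin (a + b) → ℕ) →
    ∑[ x ∈ xs ] f x ≡ ∑[ i ∈ lefts xs ] f (i ↑ˡ b) + ∑[ j ∈ rights xs ] f (a ↑ʳ j)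
  sumOver-lefts-rights []       f = refl
  sumOver-lefts-rights (x ∷ xs) f with splitAt a x in eq
  ... | inj₁ i rewrite splitAt⁻¹-↑ˡ eq =
    trans (cong (f x +_) (sumOver-lefts-rights xs f)) (sym (+-assoc (f x) _ _))
  ... | inj₂ j rewrite splitAt⁻¹-↑ʳ eq =
    trans (cong (f x +_) (sumOver-lefts-rights xs f)) (x+[y+z]≡y+[x+z] (f x) (∑[ i ∈ lefts xs ] f (i ↑ˡ b)) _)
    where
    x+[y+z]≡y+[x+z] : ∀ x y z → x + (y + z) ≡ y + (x + z)
    x+[y+z]≡y+[x+z] = solve-∀

  length-lefts-rights : ∀ xs → length xs ≡ length (lefts xs) + length (rights xs)
  length-lefts-rights xs = begin
    length xs                                              ≡⟨ length≡sumOver-1 xs ⟩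
    ∑[ x ∈ xs ] 1                                          ≡⟨ sumOver-lefts-rights xs (λ _ → 1) ⟩
    ∑[ i ∈ lefts xs ] 1 + ∑[ j ∈ rights xs ] 1             ≡⟨ cong₂ _+_ (length≡sumOver-1 (lefts xs)) (length≡sumOver-1 (rights xs)) ⟨
    length (lefts xs) + length (rights xs)                 ∎
    where open ≡-Reasoning

  ∈-lefts : ∀ xs {i} → i ∈ lefts xs → i ↑ˡ b ∈ xs
  ∈-lefts (x ∷ xs) i∈ with splitAt a x in eq
  ∈-lefts (x ∷ xs) (here refl) | inj₁ _ = here (splitAt⁻¹-↑ˡ eq)
  ∈-lefts (x ∷ xs) (there i∈)  | inj₁ _ = there (∈-lefts xs i∈)
  ∈-lefts (x ∷ xs) i∈          | inj₂ _ = there (∈-lefts xs i∈)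

  ∈-rights : ∀ xs {j} → j ∈ rights xs → a ↑ʳ j ∈ xs
  ∈-rights (x ∷ xs) j∈ with splitAt a x in eq
  ∈-rights (x ∷ xs) j∈          | inj₁ _ = there (∈-rights xs j∈)
  ∈-rights (x ∷ xs) (here refl) | inj₂ _ = here (splitAt⁻¹-↑ʳ eq)
  ∈-rights (x ∷ xs) (there j∈)  | inj₂ _ = there (∈-rights xs j∈)

  disjoint-lefts : ∀ {xs ys} → Disjoint xs ys → Disjoint (lefts xs) (lefts ys)
  disjoint-lefts {xs} {ys} xs#ys (p , q) = xs#ys (∈-lefts xs p , ∈-lefts ys q)

  disjoint-rights : ∀ {xs ys} → Disjoint xs ys → Disjoint (rights xs) (rights ys)
  disjoint-rights {xs} {ys} xs#ys (p , q) = xs#ys (∈-rights xs p , ∈-rights ys q)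

𝟙 : Bool → ℕ
𝟙 x = if x then 1 else 0

#pairs : ∀ {m} {t : Tree m} → (Bool → ℕ) → Flips t → List (Fin m) → List (Fin m) → ℕ
#pairs w f A B = ∑[ i ∈ A ] ∑[ j ∈ B ] w (above f i j)

#above #below : ∀ {m} {t : Tree m} → Flips t → List (Fin m) → List (Fin m) → ℕ
#above = #pairs 𝟙
#below = #pairs (𝟙 ∘ not)

module _ {a b} {l : Tree a} {r : Tree b} (w : Bool → ℕ) (c : Bool) (fl : Flips l) (fr : Flips r) where

  #pairs-node : ∀ A B → #pairs w (fnode c fl fr) A B ≡
    #pairs w fl (lefts a A) (lefts a B) + #pairs w fr (rights a A) (rights a B) +
    (length (lefts a A) * length (rights a B) * w (not c) + length (rights a A) * length (lefts a B) * w c)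
  #pairs-node A B = begin
    #pairs w f A B
      ≡⟨ sumOver-lefts-rights a A _ ⟩
    ∑[ i ∈ A₁ ] ∑[ j ∈ B ] w (above f (i ↑ˡ b) j) + ∑[ i ∈ A₂ ] ∑[ j ∈ B ] w (above f (a ↑ʳ i) j)
      ≡⟨ cong₂ _+_ (sumOver-cong A₁ row-↑ˡ) (sumOver-cong A₂ row-↑ʳ) ⟩
    ∑[ i ∈ A₁ ] (∑[ j ∈ B₁ ] w (above fl i j) + β₂ * w (not c)) +
    ∑[ i ∈ A₂ ] (β₁ * w c + ∑[ j ∈ B₂ ] w (above fr i j))
      ≡⟨ cong₂ _+_ (sumOver-distrib-+ A₁ _ _) (sumOver-distrib-+ A₂ _ _) ⟩
    (#pairs w fl A₁ B₁ + ∑[ i ∈ A₁ ] (β₂ * w (not c))) + (∑[ i ∈ A₂ ] (β₁ * w c) + #pairs w fr A₂ B₂)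
      ≡⟨ cong₂ (λ u v → (#pairs w fl A₁ B₁ + u) + (v + #pairs w fr A₂ B₂))
               (sumOver-const A₁ _) (sumOver-const A₂ _) ⟩
    (#pairs w fl A₁ B₁ + α₁ * (β₂ * w (not c))) + (α₂ * (β₁ * w c) + #pairs w fr A₂ B₂)
      ≡⟨ rearrange (#pairs w fl A₁ B₁) (#pairs w fr A₂ B₂) α₁ α₂ β₁ β₂ (w (not c)) (w c) ⟩
    #pairs w fl A₁ B₁ + #pairs w fr A₂ B₂ + (α₁ * β₂ * w (not c) + α₂ * β₁ * w c) ∎
    where
    open ≡-Reasoning
    f : Flips (node l r)
    f = fnode c fl fr
    A₁ B₁ : List (Fin a)
    A₁ = lefts a A
    B₁ = lefts a B
    A₂ B₂ : List (Fin b)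
    A₂ = rights a A
    B₂ = rights a B
    α₁ α₂ β₁ β₂ : ℕ
    α₁ = length A₁
    α₂ = length A₂
    β₁ = length B₁
    β₂ = length B₂

    row-↑ˡ : ∀ i → ∑[ j ∈ B ] w (above f (i ↑ˡ b) j) ≡ ∑[ j ∈ B₁ ] w (above fl i j) + β₂ * w (not c)
    row-↑ˡ i = trans (sumOver-lefts-rights a B _) (cong₂ _+_
      (sumOver-cong B₁ (λ j → cong w (above-↑ˡ-↑ˡ fl fr c i j)))
      (trans (sumOver-cong B₂ (λ j → cong w (above-↑ˡ-↑ʳ fl fr c i j))) (sumOver-const B₂ _)))

    row-↑ʳ : ∀ i → ∑[ j ∈ B ] w (above f (a ↑ʳ i) j) ≡ β₁ * w c + ∑[ j ∈ B₂ ] w (above fr i j)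
    row-↑ʳ i = trans (sumOver-lefts-rights a B _) (cong₂ _+_
      (trans (sumOver-cong B₁ (λ j → cong w (above-↑ʳ-↑ˡ fl fr c i j))) (sumOver-const B₁ _))
      (sumOver-cong B₂ (λ j → cong w (above-↑ʳ-↑ʳ fl fr c i j))))

    rearrange : ∀ x y α₁ α₂ β₁ β₂ u v →
      (x + α₁ * (β₂ * u)) + (α₂ * (β₁ * v) + y) ≡ x + y + (α₁ * β₂ * u + α₂ * β₁ * v)
    rearrange = solve-∀

module _ {a b} {l : Tree a} {r : Tree b} where

  sumOver-orientation : (Flips (node l r) → ℕ) → Bool → ℕ
  sumOver-orientation F c = ∑[ y₁ ∈ allFlips l ] ∑[ y₂ ∈ allFlips r ] F (fnode c y₁ y₂)

  sumOver-allFlips-node : ∀ F → ∑[ y ∈ allFlips (node l r) ] F y ≡ sumOver-orientation F true + sumOver-orientation F false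
  sumOver-allFlips-node F = begin
    ∑[ y ∈ allFlips (node l r) ] F y
      ≡⟨ sumOver-concatMap byOrientation (true ∷ false ∷ []) F ⟩
    ∑[ y ∈ byOrientation true ] F y + (∑[ y ∈ byOrientation false ] F y + 0)
      ≡⟨ cong₂ _+_ (byOrientation-sum true) (trans (+-identityʳ _) (byOrientation-sum false)) ⟩
    sumOver-orientation F true + sumOver-orientation F false ∎
    where
    open ≡-Reasoning
    byOrientation : Bool → List (Flips (node l r))
    byOrientation c = concatMap (λ y₁ → map (fnode c y₁) (allFlips r)) (allFlips l)
    byOrientation-sum : ∀ c → ∑[ y ∈ byOrientation c ] F y ≡ sumOver-orientation F c
    byOrientation-sum c = trans (sumOver-concatMap _ (allFlips l) F)
      (sumOver-cong (allFlips l) (λ y₁ → sumOver-map (fnode c y₁) (allFlips r) F))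

module _ {a b} {l : Tree a} {r : Tree b} (F : Flips (node l r) → ℕ) where

  private
    open ≤-Reasoning

    grid : ℕ
    grid = ∑[ y₁ ∈ allFlips l ] ∑[ y₂ ∈ allFlips r ] 1

    length-allFlips-node : length (allFlips (node l r)) ≡ grid + grid
    length-allFlips-node = trans (length≡sumOver-1 (allFlips (node l r))) (sumOver-allFlips-node {l = l} {r = r} (λ _ → 1))

  length-allFlips≤sumOver-byOrientation : (∀ c → grid ≤ sumOver-orientation F c) →
                                          length (allFlips (node l r)) ≤ ∑[ y ∈ allFlips (node l r) ] F y
  length-allFlips≤sumOver-byOrientation grid≤ = begin
    length (allFlips (node l r))                        ≡⟨ length-allFlips-node ⟩
    grid + grid                                         ≤⟨ +-mono-≤ (grid≤ true) (grid≤ false) ⟩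
    sumOver-orientation F true + sumOver-orientation F false ≡⟨ sumOver-allFlips-node F ⟨
    ∑[ y ∈ allFlips (node l r) ] F y                    ∎

  length-allFlips≤sumOver-byLeft :
    (∀ c y₂ → length (allFlips l) ≤ ∑[ y₁ ∈ allFlips l ] F (fnode c y₁ y₂)) →
    length (allFlips (node l r)) ≤ ∑[ y ∈ allFlips (node l r) ] F y
  length-allFlips≤sumOver-byLeft IH = length-allFlips≤sumOver-byOrientation λ c → begin
    grid                                                  ≡⟨ sumOver-comm (allFlips l) (allFlips r) _ ⟩
    ∑[ y₂ ∈ allFlips r ] ∑[ y₁ ∈ allFlips l ] 1          ≡⟨ sumOver-cong (allFlips r) (λ _ → length≡sumOver-1 (allFlips l)) ⟨
    ∑[ y₂ ∈ allFlips r ] length (allFlips l)             ≤⟨ sumOver-mono-≤ (allFlips r) (IH c) ⟩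
    ∑[ y₂ ∈ allFlips r ] ∑[ y₁ ∈ allFlips l ] F (fnode c y₁ y₂) ≡⟨ sumOver-comm (allFlips l) (allFlips r) _ ⟨
    sumOver-orientation F c                                 ∎

  length-allFlips≤sumOver-byRight :
    (∀ c y₁ → length (allFlips r) ≤ ∑[ y₂ ∈ allFlips r ] F (fnode c y₁ y₂)) →
    length (allFlips (node l r)) ≤ ∑[ y ∈ allFlips (node l r) ] F y
  length-allFlips≤sumOver-byRight IH = length-allFlips≤sumOver-byOrientation λ c → begin
    grid                                      ≡⟨ sumOver-cong (allFlips l) (λ _ → length≡sumOver-1 (allFlips r)) ⟨
    ∑[ y₁ ∈ allFlips l ] length (allFlips r)  ≤⟨ sumOver-mono-≤ (allFlips l) (IH c) ⟩
    sumOver-orientation F c                     ∎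

  length-allFlips≤sumOver-byFlip :
    (∀ y₁ y₂ → 2 ≤ F (fnode true y₁ y₂) + F (fnode false y₁ y₂)) →
    length (allFlips (node l r)) ≤ ∑[ y ∈ allFlips (node l r) ] F y
  length-allFlips≤sumOver-byFlip 2≤ = begin
    length (allFlips (node l r))                       ≡⟨ length-allFlips-node ⟩
    grid + grid                                        ≡⟨ sumOver²-distrib-+ (λ _ _ → 1) (λ _ _ → 1) ⟨
    ∑[ y₁ ∈ allFlips l ] ∑[ y₂ ∈ allFlips r ] 2       ≤⟨ sumOver-mono-≤ (allFlips l) (λ y₁ → sumOver-mono-≤ (allFlips r) (2≤ y₁)) ⟩
    ∑[ y₁ ∈ allFlips l ] ∑[ y₂ ∈ allFlips r ] (F (fnode true y₁ y₂) + F (fnode false y₁ y₂))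
                                                       ≡⟨ sumOver²-distrib-+ _ _ ⟩
    sumOver-orientation F true + sumOver-orientation F false ≡⟨ sumOver-allFlips-node F ⟨
    ∑[ y ∈ allFlips (node l r) ] F y                   ∎
    where
    sumOver²-distrib-+ : ∀ (g h : Flips l → Flips r → ℕ) →
      ∑[ y₁ ∈ allFlips l ] ∑[ y₂ ∈ allFlips r ] (g y₁ y₂ + h y₁ y₂) ≡
      ∑[ y₁ ∈ allFlips l ] ∑[ y₂ ∈ allFlips r ] g y₁ y₂ + ∑[ y₁ ∈ allFlips l ] ∑[ y₂ ∈ allFlips r ] h y₁ y₂
    sumOver²-distrib-+ g h =
      trans (sumOver-cong (allFlips l) (λ y₁ → sumOver-distrib-+ (allFlips r) (g y₁) (h y₁)))
            (sumOver-distrib-+ (allFlips l) _ _)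

sameSide⊎separated : ∀ α₁ α₂ β₁ β₂ → 0 < α₁ + α₂ → 0 < β₁ + β₂ →
                     (0 < α₁ × 0 < β₁) ⊎ (0 < α₂ × 0 < β₂) ⊎ 0 < ∣ α₁ * β₂ - α₂ * β₁ ∣
sameSide⊎separated (suc _) _       (suc _) _       _  _  = inj₁ (s≤s z≤n , s≤s z≤n)
sameSide⊎separated _       (suc _) _       (suc _) _  _  = inj₂ (inj₁ (s≤s z≤n , s≤s z≤n))
sameSide⊎separated zero    (suc _) (suc _) zero    _  _  = inj₂ (inj₂ (s≤s z≤n))
sameSide⊎separated (suc _) zero    zero    (suc _) _  _  = inj₂ (inj₂ (s≤s z≤n))
sameSide⊎separated zero    zero    _       _       () _
sameSide⊎separated _       _       zero    zero    _  ()

2*∣p-q∣≤∣u+q-v+p∣+∣u+p-v+q∣ : ∀ u v p q → 2 * ∣ p - q ∣ ≤ ∣ u + q - v + p ∣ + ∣ u + p - v + q ∣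
2*∣p-q∣≤∣u+q-v+p∣+∣u+p-v+q∣ u v p q = begin
  2 * ∣ p - q ∣                                            ≡⟨ *-distribˡ-∣-∣ 2 p q ⟩
  ∣ 2 * p - 2 * q ∣                                        ≡⟨ ∣m+n-m+o∣≡∣n-o∣ v (2 * p) (2 * q) ⟨
  ∣ v + 2 * p - v + 2 * q ∣                                ≡⟨ cong₂ ∣_-_∣ (double v p) (double v q) ⟩
  ∣ p + (v + p) - q + (v + q) ∣                            ≤⟨ ∣-∣-triangle (p + (v + p)) (p + (u + q)) (q + (v + q)) ⟩
  ∣ p + (v + p) - p + (u + q) ∣ + ∣ p + (u + q) - q + (v + q) ∣
    ≡⟨ cong₂ _+_ (trans (∣m+n-m+o∣≡∣n-o∣ p (v + p) (u + q)) (∣-∣-comm (v + p) (u + q)))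
                 (trans (cong (λ z → ∣ z - q + (v + q) ∣) (exchange p u q)) (∣m+n-m+o∣≡∣n-o∣ q (u + p) (v + q))) ⟩
  ∣ u + q - v + p ∣ + ∣ u + p - v + q ∣                    ∎
  where
  open ≤-Reasoning
  double : ∀ v p → v + 2 * p ≡ p + (v + p)
  double = solve-∀
  exchange : ∀ p u q → p + (u + q) ≡ q + (u + p)
  exchange = solve-∀

module ImbalanceAtNode {a b} (l : Tree a) (r : Tree b) (A B : List (Fin (a + b))) (u v : ℕ) where

  private
    A₁ B₁ : List (Fin a)
    A₁ = lefts a A
    B₁ = lefts a B
    A₂ B₂ : List (Fin b)
    A₂ = rights a A
    B₂ = rights a B
    p q : ℕ
    p = length A₁ * length B₂
    q = length A₂ * length B₁

    F : Flips (node l r) → ℕ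
    F y = ∣ #above y A B + u - #below y A B + v ∣

    aboveAcross belowAcross : Bool → ℕ
    aboveAcross c = p * 𝟙 (not c) + q * 𝟙 c
    belowAcross c = p * 𝟙 (not (not c)) + q * 𝟙 (not c)

    F-node : ∀ c y₁ y₂ → F (fnode c y₁ y₂) ≡
      ∣ #above y₁ A₁ B₁ + #above y₂ A₂ B₂ + aboveAcross c + u - #below y₁ A₁ B₁ + #below y₂ A₂ B₂ + belowAcross c + v ∣
    F-node c y₁ y₂ = cong₂ (λ x z → ∣ x + u - z + v ∣) (#pairs-node 𝟙 c y₁ y₂ A B) (#pairs-node (𝟙 ∘ not) c y₁ y₂ A B)

    x+y+k+u≡x+[y+k+u] : ∀ x y k u → x + y + k + u ≡ x + (y + k + u)
    x+y+k+u≡x+[y+k+u] = solve-∀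

    x+y+k+u≡y+[x+k+u] : ∀ x y k u → x + y + k + u ≡ y + (x + k + u)
    x+y+k+u≡y+[x+k+u] = solve-∀

  byLeft : (∀ u′ v′ → length (allFlips l) ≤ ∑[ y₁ ∈ allFlips l ] ∣ #above y₁ A₁ B₁ + u′ - #below y₁ A₁ B₁ + v′ ∣) →
           length (allFlips (node l r)) ≤ ∑[ y ∈ allFlips (node l r) ] F y
  byLeft IH = length-allFlips≤sumOver-byLeft F λ c y₂ →
    subst (length (allFlips l) ≤_)
      (sumOver-cong (allFlips l) λ y₁ → sym (trans (F-node c y₁ y₂)
        (cong₂ ∣_-_∣ (x+y+k+u≡x+[y+k+u] (#above y₁ A₁ B₁) (#above y₂ A₂ B₂) (aboveAcross c) u)
                     (x+y+k+u≡x+[y+k+u] (#below y₁ A₁ B₁) (#below y₂ A₂ B₂) (belowAcross c) v))))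
      (IH (#above y₂ A₂ B₂ + aboveAcross c + u) (#below y₂ A₂ B₂ + belowAcross c + v))

  byRight : (∀ u′ v′ → length (allFlips r) ≤ ∑[ y₂ ∈ allFlips r ] ∣ #above y₂ A₂ B₂ + u′ - #below y₂ A₂ B₂ + v′ ∣) →
            length (allFlips (node l r)) ≤ ∑[ y ∈ allFlips (node l r) ] F y
  byRight IH = length-allFlips≤sumOver-byRight F λ c y₁ →
    subst (length (allFlips r) ≤_)
      (sumOver-cong (allFlips r) λ y₂ → sym (trans (F-node c y₁ y₂)
        (cong₂ ∣_-_∣ (x+y+k+u≡y+[x+k+u] (#above y₁ A₁ B₁) (#above y₂ A₂ B₂) (aboveAcross c) u)
                     (x+y+k+u≡y+[x+k+u] (#below y₁ A₁ B₁) (#below y₂ A₂ B₂) (belowAcross c) v))))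
      (IH (#above y₁ A₁ B₁ + aboveAcross c + u) (#below y₁ A₁ B₁ + belowAcross c + v))

  bySeparation : 0 < ∣ p - q ∣ → length (allFlips (node l r)) ≤ ∑[ y ∈ allFlips (node l r) ] F y
  bySeparation 0<∣p-q∣ = length-allFlips≤sumOver-byFlip F λ y₁ y₂ → begin
    2                                                  ≤⟨ *-monoʳ-≤ 2 0<∣p-q∣ ⟩
    2 * ∣ p - q ∣                                      ≤⟨ 2*∣p-q∣≤∣u+q-v+p∣+∣u+p-v+q∣ (X y₁ y₂ + u) (Z y₁ y₂ + v) p q ⟩
    ∣ X y₁ y₂ + u + q - Z y₁ y₂ + v + p ∣ + ∣ X y₁ y₂ + u + p - Z y₁ y₂ + v + q ∣
      ≡⟨ cong₂ _+_ (trans (F-node true y₁ y₂) (cong₂ ∣_-_∣ (crossed (X y₁ y₂) u p q) (uncrossed (Z y₁ y₂) v p q)))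
                   (trans (F-node false y₁ y₂) (cong₂ ∣_-_∣ (uncrossed (X y₁ y₂) u p q) (crossed (Z y₁ y₂) v p q))) ⟨
    F (fnode true y₁ y₂) + F (fnode false y₁ y₂)       ∎
    where
    open ≤-Reasoning
    X Z : Flips l → Flips r → ℕ
    X y₁ y₂ = #above y₁ A₁ B₁ + #above y₂ A₂ B₂
    Z y₁ y₂ = #below y₁ A₁ B₁ + #below y₂ A₂ B₂
    crossed : ∀ x u p q → x + (p * 0 + q * 1) + u ≡ x + u + q
    crossed = solve-∀
    uncrossed : ∀ x u p q → x + (p * 1 + q * 0) + u ≡ x + u + p
    uncrossed = solve-∀

-- The offsets u and v absorb the pairs lying outside the subtree the induction descends into.
average-∣#above-#below∣≥1 : ∀ {m} (R : Tree m) (A B : List (Fin m)) → 0 < length A → 0 < length B → Disjoint A B →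
  ∀ u v → length (allFlips R) ≤ ∑[ y ∈ allFlips R ] ∣ #above y A B + u - #below y A B + v ∣
average-∣#above-#below∣≥1 leaf []           _            ()  _  _   _ _
average-∣#above-#below∣≥1 leaf (_ ∷ _)      []           _   () _   _ _
average-∣#above-#below∣≥1 leaf (zero ∷ _)   (zero ∷ _)   _   _  A#B _ _ = ⊥-elim (A#B (here refl , here refl))
average-∣#above-#below∣≥1 (node {a} l r) A B A⁺ B⁺ A#B u v
  with sameSide⊎separated _ _ _ _ (subst (0 <_) (length-lefts-rights a A) A⁺) (subst (0 <_) (length-lefts-rights a B) B⁺)
... | inj₁ (A₁⁺ , B₁⁺) =
  ImbalanceAtNode.byLeft l r A B u v (average-∣#above-#below∣≥1 l (lefts a A) (lefts a B) A₁⁺ B₁⁺ (disjoint-lefts a A#B))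
... | inj₂ (inj₁ (A₂⁺ , B₂⁺)) =
  ImbalanceAtNode.byRight l r A B u v (average-∣#above-#below∣≥1 r (rights a A) (rights a B) A₂⁺ B₂⁺ (disjoint-rights a A#B))
... | inj₂ (inj₂ 0<∣p-q∣) = ImbalanceAtNode.bySeparation l r A B u v 0<∣p-q∣

crossing : ∀ {k} {t : Tree k} → Flips t → (Fin k → ℕ) → Fin k → Fin k → ℕ
crossing f q i j = if toℕ i <ᵇ toℕ j then 𝟙 (above f i j xor (q i <ᵇ q j)) else 0

crossingsAgainst : ∀ {k} {t : Tree k} → Flips t → (Fin k → ℕ) → ℕ
crossingsAgainst {k} f q = ∑[ i < k ] ∑[ j < k ] crossing f q i j

#ordered #inverted : ∀ a b → (Fin (a + b) → ℕ) → ℕ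
#ordered  a b q = ∑[ i < a ] ∑[ j < b ] 𝟙 (q (i ↑ˡ b) <ᵇ q (a ↑ʳ j))
#inverted a b q = ∑[ i < a ] ∑[ j < b ] 𝟙 (not (q (i ↑ˡ b) <ᵇ q (a ↑ʳ j)))

#ordered+#inverted≡* : ∀ a b q → #ordered a b q + #inverted a b q ≡ a * b
#ordered+#inverted≡* a b q = begin
  #ordered a b q + #inverted a b q
    ≡⟨ ∑-distrib-+ (λ i → ∑[ j < b ] 𝟙 (z i j)) (λ i → ∑[ j < b ] 𝟙 (not (z i j))) ⟨
  ∑[ i < a ] (∑[ j < b ] 𝟙 (z i j) + ∑[ j < b ] 𝟙 (not (z i j)))
    ≡⟨ sum-cong-≗ (λ i → sym (∑-distrib-+ (λ j → 𝟙 (z i j)) (λ j → 𝟙 (not (z i j))))) ⟩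
  ∑[ i < a ] ∑[ j < b ] (𝟙 (z i j) + 𝟙 (not (z i j)))
    ≡⟨ sum-cong-≗ (λ i → trans (sum-cong-≗ (λ j → 𝟙+𝟙∘not (z i j))) (trans (∑-const b 1) (*-identityʳ b))) ⟩
  ∑[ i < a ] b
    ≡⟨ ∑-const a b ⟩
  a * b ∎
  where
  open ≡-Reasoning
  z : Fin a → Fin b → Bool
  z i j = q (i ↑ˡ b) <ᵇ q (a ↑ʳ j)
  𝟙+𝟙∘not : ∀ x → 𝟙 x + 𝟙 (not x) ≡ 1
  𝟙+𝟙∘not true  = refl
  𝟙+𝟙∘not false = refl

imbalance : ∀ {k} → Tree k → (Fin k → ℕ) → ℕ
imbalance leaf               q = 0
imbalance (node {a} {b} l r) q =
  imbalance l (q ∘ (_↑ˡ b)) + imbalance r (q ∘ (a ↑ʳ_)) + ∣ #ordered a b q - #inverted a b q ∣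

#leafPairs : ∀ {k} → Tree k → ℕ
#leafPairs leaf               = 0
#leafPairs (node {a} {b} l r) = #leafPairs l + #leafPairs r + a * b

2*#leafPairs+k≡k*k : ∀ {k} (t : Tree k) → 2 * #leafPairs t + k ≡ k * k
2*#leafPairs+k≡k*k leaf               = refl
2*#leafPairs+k≡k*k (node {a} {b} l r) = begin
  2 * (#leafPairs l + #leafPairs r + a * b) + (a + b)           ≡⟨ regroup (#leafPairs l) (#leafPairs r) a b ⟩
  (2 * #leafPairs l + a) + (2 * #leafPairs r + b) + 2 * (a * b) ≡⟨ cong₂ (λ x y → x + y + 2 * (a * b)) (2*#leafPairs+k≡k*k l) (2*#leafPairs+k≡k*k r) ⟩
  a * a + b * b + 2 * (a * b)                                   ≡⟨ square a b ⟩
  (a + b) * (a + b)                                             ∎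
  where
  open ≡-Reasoning
  regroup : ∀ x y a b → 2 * (x + y + a * b) + (a + b) ≡ (2 * x + a) + (2 * y + b) + 2 * (a * b)
  regroup = solve-∀
  square : ∀ a b → a * a + b * b + 2 * (a * b) ≡ (a + b) * (a + b)
  square = solve-∀

↑ˡ<↑ʳ : ∀ {a b} (i : Fin a) (j : Fin b) → toℕ (i ↑ˡ b) < toℕ (a ↑ʳ j)
↑ˡ<↑ʳ {a} {b} i j = subst₂ _<_ (sym (toℕ-↑ˡ i b)) (sym (toℕ-↑ʳ a j)) (≤-trans (toℕ<n i) (m≤m+n a (toℕ j)))

#crossedAcross≡ : ∀ a b q c → ∑[ i < a ] ∑[ j < b ] 𝟙 (not c xor (q (i ↑ˡ b) <ᵇ q (a ↑ʳ j))) ≡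
                                (if c then #ordered a b q else #inverted a b q)
#crossedAcross≡ a b q true  = refl
#crossedAcross≡ a b q false = refl

module _ {a b} {l : Tree a} {r : Tree b} (c : Bool) (fl : Flips l) (fr : Flips r) (q : Fin (a + b) → ℕ) where

  private
    f : Flips (node l r)
    f = fnode c fl fr

    crossing-↑ˡ-↑ˡ : ∀ i j → crossing f q (i ↑ˡ b) (j ↑ˡ b) ≡ crossing fl (q ∘ (_↑ˡ b)) i j
    crossing-↑ˡ-↑ˡ i j rewrite toℕ-↑ˡ i b | toℕ-↑ˡ j b | above-↑ˡ-↑ˡ fl fr c i j = refl

    crossing-↑ˡ-↑ʳ : ∀ i j → crossing f q (i ↑ˡ b) (a ↑ʳ j) ≡ 𝟙 (not c xor (q (i ↑ˡ b) <ᵇ q (a ↑ʳ j)))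
    crossing-↑ˡ-↑ʳ i j rewrite <⇒<ᵇ≡true (↑ˡ<↑ʳ i j) | above-↑ˡ-↑ʳ fl fr c i j = refl

    crossing-↑ʳ-↑ˡ : ∀ i j → crossing f q (a ↑ʳ i) (j ↑ˡ b) ≡ 0
    crossing-↑ʳ-↑ˡ i j rewrite ≤⇒<ᵇ≡false (<⇒≤ (↑ˡ<↑ʳ j i)) = refl

    crossing-↑ʳ-↑ʳ : ∀ i j → crossing f q (a ↑ʳ i) (a ↑ʳ j) ≡ crossing fr (q ∘ (a ↑ʳ_)) i j
    crossing-↑ʳ-↑ʳ i j rewrite toℕ-↑ʳ a i | toℕ-↑ʳ a j | +-cancelˡ-<ᵇ a (toℕ i) (toℕ j) | above-↑ʳ-↑ʳ fl fr c i j = refl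

    across : ℕ
    across = ∑[ i < a ] ∑[ j < b ] 𝟙 (not c xor (q (i ↑ˡ b) <ᵇ q (a ↑ʳ j)))

  crossingsAgainst-node : crossingsAgainst f q ≡
    crossingsAgainst fl (q ∘ (_↑ˡ b)) + crossingsAgainst fr (q ∘ (a ↑ʳ_)) + (if c then #ordered a b q else #inverted a b q)
  crossingsAgainst-node = begin
    crossingsAgainst f q
      ≡⟨ ∑-split a b (λ i → ∑[ j < a + b ] crossing f q i j) ⟩
    ∑[ i < a ] ∑[ j < a + b ] crossing f q (i ↑ˡ b) j + ∑[ i < b ] ∑[ j < a + b ] crossing f q (a ↑ʳ i) j
      ≡⟨ cong₂ _+_ (sum-cong-≗ λ i → ∑-split a b (crossing f q (i ↑ˡ b))) (sum-cong-≗ λ i → ∑-split a b (crossing f q (a ↑ʳ i))) ⟩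
    ∑[ i < a ] (∑[ j < a ] crossing f q (i ↑ˡ b) (j ↑ˡ b) + ∑[ j < b ] crossing f q (i ↑ˡ b) (a ↑ʳ j)) +
    ∑[ i < b ] (∑[ j < a ] crossing f q (a ↑ʳ i) (j ↑ˡ b) + ∑[ j < b ] crossing f q (a ↑ʳ i) (a ↑ʳ j))
      ≡⟨ cong₂ _+_ (∑-distrib-+ (λ i → ∑[ j < a ] crossing f q (i ↑ˡ b) (j ↑ˡ b)) (λ i → ∑[ j < b ] crossing f q (i ↑ˡ b) (a ↑ʳ j)))
                   (∑-distrib-+ (λ i → ∑[ j < a ] crossing f q (a ↑ʳ i) (j ↑ˡ b)) (λ i → ∑[ j < b ] crossing f q (a ↑ʳ i) (a ↑ʳ j))) ⟩
    (∑[ i < a ] ∑[ j < a ] crossing f q (i ↑ˡ b) (j ↑ˡ b) + ∑[ i < a ] ∑[ j < b ] crossing f q (i ↑ˡ b) (a ↑ʳ j)) +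
    (∑[ i < b ] ∑[ j < a ] crossing f q (a ↑ʳ i) (j ↑ˡ b) + ∑[ i < b ] ∑[ j < b ] crossing f q (a ↑ʳ i) (a ↑ʳ j))
      ≡⟨ cong₂ _+_ (cong₂ _+_ (sum-cong-≗ λ i → sum-cong-≗ (crossing-↑ˡ-↑ˡ i)) (sum-cong-≗ λ i → sum-cong-≗ (crossing-↑ˡ-↑ʳ i)))
                   (cong₂ _+_ (trans (sum-cong-≗ λ i → trans (sum-cong-≗ (crossing-↑ʳ-↑ˡ i)) (∑-zero a)) (∑-zero b))
                              (sum-cong-≗ λ i → sum-cong-≗ (crossing-↑ʳ-↑ʳ i))) ⟩
    (crossingsAgainst fl (q ∘ (_↑ˡ b)) + across) + (0 + crossingsAgainst fr (q ∘ (a ↑ʳ_)))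
      ≡⟨ x+z+[0+y]≡x+y+z (crossingsAgainst fl (q ∘ (_↑ˡ b))) (crossingsAgainst fr (q ∘ (a ↑ʳ_))) across ⟩
    crossingsAgainst fl (q ∘ (_↑ˡ b)) + crossingsAgainst fr (q ∘ (a ↑ʳ_)) + across
      ≡⟨ cong (_ +_) (#crossedAcross≡ a b q c) ⟩
    crossingsAgainst fl (q ∘ (_↑ˡ b)) + crossingsAgainst fr (q ∘ (a ↑ʳ_)) + (if c then #ordered a b q else #inverted a b q) ∎
    where
    open ≡-Reasoning
    ∑-zero : ∀ n → ∑[ i < n ] 0 ≡ 0
    ∑-zero n = trans (∑-const n 0) (*-zeroʳ n)
    x+z+[0+y]≡x+y+z : ∀ x y z → x + z + (0 + y) ≡ x + y + z
    x+z+[0+y]≡x+y+z = solve-∀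

2*min+∣-∣≡+ : ∀ x y → Σ Bool λ c → 2 * (if c then x else y) + ∣ x - y ∣ ≡ x + y
2*min+∣-∣≡+ x y with x ≤? y
... | yes x≤y = true , (begin
  2 * x + ∣ x - y ∣   ≡⟨ cong₂ _+_ (cong (x +_) (+-identityʳ x)) (m≤n⇒∣m-n∣≡n∸m x≤y) ⟩
  x + x + (y ∸ x)     ≡⟨ +-assoc x x (y ∸ x) ⟩
  x + (x + (y ∸ x))   ≡⟨ cong (x +_) (m+[n∸m]≡n x≤y) ⟩
  x + y               ∎)
  where open ≡-Reasoning
... | no x≰y = false , (begin
  2 * y + ∣ x - y ∣   ≡⟨ cong₂ _+_ (cong (y +_) (+-identityʳ y)) (trans (∣-∣-comm x y) (m≤n⇒∣m-n∣≡n∸m y≤x)) ⟩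
  y + y + (x ∸ y)     ≡⟨ +-assoc y y (x ∸ y) ⟩
  y + (y + (x ∸ y))   ≡⟨ cong (y +_) (m+[n∸m]≡n y≤x) ⟩
  y + x               ≡⟨ +-comm y x ⟩
  x + y               ∎)
  where
  open ≡-Reasoning
  y≤x : y ≤ x
  y≤x = <⇒≤ (≰⇒> x≰y)

greedyLayout : ∀ {k} (t : Tree k) (q : Fin k → ℕ) → Σ (Flips t) λ f → 2 * crossingsAgainst f q + imbalance t q ≤ #leafPairs t
greedyLayout leaf q = fleaf , z≤n
greedyLayout (node {a} {b} l r) q
  with greedyLayout l (q ∘ (_↑ˡ b)) | greedyLayout r (q ∘ (a ↑ʳ_)) | 2*min+∣-∣≡+ (#ordered a b q) (#inverted a b q)
... | fl , l-bound | fr , r-bound | c , cheaper = fnode c fl fr , (begin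
  2 * crossingsAgainst (fnode c fl fr) q + imbalance (node l r) q
    ≡⟨ cong (λ x → 2 * x + imbalance (node l r) q) (crossingsAgainst-node c fl fr q) ⟩
  2 * (Cl + Cr + M) + (imbalance l ql + imbalance r qr + Δ)
    ≡⟨ regroup Cl Cr M (imbalance l ql) (imbalance r qr) Δ ⟩
  (2 * Cl + imbalance l ql) + (2 * Cr + imbalance r qr) + (2 * M + Δ)
    ≤⟨ +-mono-≤ (+-mono-≤ l-bound r-bound) (≤-reflexive (trans cheaper (#ordered+#inverted≡* a b q))) ⟩
  #leafPairs l + #leafPairs r + a * b ∎)
  where
  open ≤-Reasoning
  ql : Fin a → ℕ
  ql = q ∘ (_↑ˡ b)
  qr : Fin b → ℕ
  qr = q ∘ (a ↑ʳ_)
  Cl Cr M Δ : ℕ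
  Cl = crossingsAgainst fl ql
  Cr = crossingsAgainst fr qr
  M  = if c then #ordered a b q else #inverted a b q
  Δ  = ∣ #ordered a b q - #inverted a b q ∣
  regroup : ∀ x y m u v d → 2 * (x + y + m) + (u + v + d) ≡ (2 * x + u) + (2 * y + v) + (2 * m + d)
  regroup = solve-∀

0<leaves : ∀ {k} → Tree k → 0 < k
0<leaves leaf               = s≤s z≤n
0<leaves (node {a} {b} l r) = ≤-trans (0<leaves l) (m≤m+n a b)

#pairs-tabulate : ∀ {m a b} {t : Tree m} (w : Bool → ℕ) (y : Flips t) (g : Fin a → Fin m) (h : Fin b → Fin m) →
  #pairs w y (tabulate g) (tabulate h) ≡ ∑[ i < a ] ∑[ j < b ] w (above y (g i) (h j))
#pairs-tabulate {a = a} {b} w y g h =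
  trans (sumOver-tabulate a g (λ i → ∑[ j ∈ tabulate h ] w (above y i j)))
        (sum-cong-≗ λ i → sumOver-tabulate b h (λ j → w (above y (g i) j)))

disjoint-tabulate : ∀ {m a b} (φ : Fin (a + b) → Fin m) → Injective _≡_ _≡_ φ →
                    Disjoint (tabulate (φ ∘ (_↑ˡ b))) (tabulate (φ ∘ (a ↑ʳ_)))
disjoint-tabulate φ φ-injective (x∈A , x∈B) with ∈-tabulate⁻ x∈A | ∈-tabulate⁻ x∈B
... | i , refl | j , φi≡φj = <⇒≢ (↑ˡ<↑ʳ i j) (cong toℕ (φ-injective φi≡φj))

average-imbalance+1≥k : ∀ {k m} (t : Tree k) (R : Tree m) (φ : Fin k → Fin m) → Injective _≡_ _≡_ φ →
  k * length (allFlips R) ≤ ∑[ y ∈ allFlips R ] (imbalance t (pos y ∘ φ) + 1)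
average-imbalance+1≥k leaf R φ _ = ≤-reflexive (trans (*-identityˡ _) (length≡sumOver-1 (allFlips R)))
average-imbalance+1≥k {m = m} (node {a} {b} l r) R φ φ-injective = begin
  (a + b) * Y                                              ≡⟨ *-distribʳ-+ Y a b ⟩
  a * Y + b * Y                                            ≤⟨ +-mono-≤ (average-imbalance+1≥k l R φˡ φˡ-injective)
                                                                       (average-imbalance+1≥k r R φʳ φʳ-injective) ⟩
  ∑[ y ∈ Ys ] (Dˡ y + 1) + ∑[ y ∈ Ys ] (Dʳ y + 1)          ≡⟨ cong₂ _+_ (sumOver-+1 Dˡ) (sumOver-+1 Dʳ) ⟩
  (∑[ y ∈ Ys ] Dˡ y + Y) + (∑[ y ∈ Ys ] Dʳ y + Y)          ≡⟨ regroup (∑[ y ∈ Ys ] Dˡ y) (∑[ y ∈ Ys ] Dʳ y) Y ⟩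
  ∑[ y ∈ Ys ] Dˡ y + ∑[ y ∈ Ys ] Dʳ y + Y + Y              ≤⟨ +-monoˡ-≤ Y (+-monoʳ-≤ (∑[ y ∈ Ys ] Dˡ y + ∑[ y ∈ Ys ] Dʳ y) Y≤∑Δ) ⟩
  ∑[ y ∈ Ys ] Dˡ y + ∑[ y ∈ Ys ] Dʳ y + ∑[ y ∈ Ys ] Δ y + Y ≡⟨ sumOver-node ⟨
  ∑[ y ∈ Ys ] (Dˡ y + Dʳ y + Δ y + 1)                      ∎
  where
  open ≤-Reasoning
  Ys : List (Flips R)
  Ys = allFlips R
  Y : ℕ
  Y = length Ys
  φˡ : Fin a → Fin m
  φˡ = φ ∘ (_↑ˡ b)
  φʳ : Fin b → Fin m
  φʳ = φ ∘ (a ↑ʳ_)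
  φˡ-injective : Injective _≡_ _≡_ φˡ
  φˡ-injective = ↑ˡ-injective b _ _ ∘ φ-injective
  φʳ-injective : Injective _≡_ _≡_ φʳ
  φʳ-injective = ↑ʳ-injective a _ _ ∘ φ-injective
  Dˡ Dʳ Δ : Flips R → ℕ
  Dˡ y = imbalance l (pos y ∘ φˡ)
  Dʳ y = imbalance r (pos y ∘ φʳ)
  Δ  y = ∣ #ordered a b (pos y ∘ φ) - #inverted a b (pos y ∘ φ) ∣

  sumOver-+1 : ∀ D → ∑[ y ∈ Ys ] (D y + 1) ≡ ∑[ y ∈ Ys ] D y + Y
  sumOver-+1 D = trans (sumOver-distrib-+ Ys D (λ _ → 1)) (cong (∑[ y ∈ Ys ] D y +_) (sym (length≡sumOver-1 Ys)))

  sumOver-node : ∑[ y ∈ Ys ] (Dˡ y + Dʳ y + Δ y + 1) ≡ ∑[ y ∈ Ys ] Dˡ y + ∑[ y ∈ Ys ] Dʳ y + ∑[ y ∈ Ys ] Δ y + Y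
  sumOver-node = trans (sumOver-+1 (λ y → Dˡ y + Dʳ y + Δ y)) (cong (_+ Y)
    (trans (sumOver-distrib-+ Ys _ Δ) (cong (_+ ∑[ y ∈ Ys ] Δ y) (sumOver-distrib-+ Ys Dˡ Dʳ))))

  regroup : ∀ x y n → (x + n) + (y + n) ≡ x + y + n + n
  regroup = solve-∀

  Y≤∑Δ : Y ≤ ∑[ y ∈ Ys ] Δ y
  Y≤∑Δ = subst (Y ≤_)
    (sumOver-cong Ys λ y → cong₂ ∣_-_∣
      (trans (+-identityʳ _) (#pairs-tabulate 𝟙 y φˡ φʳ))
      (trans (+-identityʳ _) (#pairs-tabulate (𝟙 ∘ not) y φˡ φʳ)))
    (average-∣#above-#below∣≥1 R (tabulate φˡ) (tabulate φʳ)
      (subst (0 <_) (sym (length-tabulate φˡ)) (0<leaves l))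
      (subst (0 <_) (sym (length-tabulate φʳ)) (0<leaves r))
      (disjoint-tabulate φ φ-injective) 0 0)

∃≥average : ∀ {A : Set} (xs : List A) (f : A → ℕ) c → 0 < length xs → c * length xs ≤ ∑[ x ∈ xs ] f x → Σ A λ x → c ≤ f x
∃≥average {A} (x ∷ xs) f c _ = go x xs
  where
  go : ∀ x xs → c * length (x ∷ xs) ≤ ∑[ z ∈ x ∷ xs ] f z → Σ A λ z → c ≤ f z
  go x []       c≤ = x , subst₂ _≤_ (*-identityʳ c) (+-identityʳ (f x)) c≤
  go x (y ∷ ys) c≤ with c ≤? f x
  ... | yes c≤fx = x , c≤fx
  ... | no  c≰fx = go y ys (+-cancelˡ-≤ c _ _ (begin
    c + c * length (y ∷ ys)      ≡⟨ *-suc c (length (y ∷ ys)) ⟨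
    c * length (x ∷ y ∷ ys)      ≤⟨ c≤ ⟩
    f x + ∑[ z ∈ y ∷ ys ] f z    ≤⟨ +-monoˡ-≤ (∑[ z ∈ y ∷ ys ] f z) (<⇒≤ (≰⇒> c≰fx)) ⟩
    c + ∑[ z ∈ y ∷ ys ] f z      ∎))
    where open ≤-Reasoning

referenceLayout : ∀ {k} (t : Tree k) → Flips t
referenceLayout leaf       = fleaf
referenceLayout (node l r) = fnode false (referenceLayout l) (referenceLayout r)

allFlips-complete : ∀ {k} {t : Tree k} (f : Flips t) → f ∈ allFlips t
allFlips-complete fleaf                = here refl
allFlips-complete {t = node l r} (fnode c fl fr) =
  ∈-concatMap⁺ byOrientation (lose (orientation∈ c)
    (∈-concatMap⁺ (λ fl → map (fnode c fl) (allFlips r)) (lose (allFlips-complete fl) (∈-map⁺ (fnode c fl) (allFlips-complete fr)))))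
  where
  byOrientation : Bool → List (Flips (node l r))
  byOrientation c = concatMap (λ fl → map (fnode c fl) (allFlips r)) (allFlips l)
  orientation∈ : ∀ c → c ∈ true ∷ false ∷ []
  orientation∈ true  = here refl
  orientation∈ false = there (here refl)

minimum-≤ : ∀ {x xs} → x ∈ xs → minimum xs ≤ x
minimum-≤ {xs = y ∷ ys} (here refl) = foldr-⊓-≤-init y ys
  where
  foldr-⊓-≤-init : ∀ y ys → foldr _⊓_ y ys ≤ y
  foldr-⊓-≤-init y []       = ≤-refl
  foldr-⊓-≤-init y (z ∷ zs) = ≤-trans (m⊓n≤n z _) (foldr-⊓-≤-init y zs)
minimum-≤ {xs = y ∷ ys} (there x∈ys) = foldr-⊓-≤ y ys x∈ys
  where
  foldr-⊓-≤ : ∀ y ys {x} → x ∈ ys → foldr _⊓_ y ys ≤ x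
  foldr-⊓-≤ y (z ∷ zs) (here refl) = m⊓n≤m z _
  foldr-⊓-≤ y (z ∷ zs) (there x∈) = ≤-trans (m⊓n≤n z _) (foldr-⊓-≤ y zs x∈)

module _ {n} (T : Tanglegram n) where
  open Tanglegram T

  crossings≡crossingsAgainst : ∀ fL fR → crossings T fL fR ≡ crossingsAgainst fL (pos fR ∘ (σ ⟨$⟩ʳ_))
  crossings≡crossingsAgainst fL fR = begin
    crossings T fL fR
      ≡⟨ sum≡sumOver (concatMap row (allFin n)) ⟩
    ∑[ x ∈ concatMap row (allFin n) ] x
      ≡⟨ sumOver-concatMap row (allFin n) (λ x → x) ⟩
    ∑[ i ∈ allFin n ] ∑[ x ∈ row i ] x
      ≡⟨ sumOver-cong (allFin n) (λ i → sumOver-map (crossing fL q i) (allFin n) (λ x → x)) ⟩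
    ∑[ i ∈ allFin n ] ∑[ j ∈ allFin n ] crossing fL q i j
      ≡⟨ trans (sumOver-tabulate n (λ i → i) (λ i → ∑[ j ∈ allFin n ] crossing fL q i j))
               (sum-cong-≗ λ i → sumOver-tabulate n (λ j → j) (crossing fL q i)) ⟩
    crossingsAgainst fL q ∎
    where
    open ≡-Reasoning
    q : Fin n → ℕ
    q = pos fR ∘ (σ ⟨$⟩ʳ_)
    row : Fin n → List ℕ
    row i = map (crossing fL q i) (allFin n)
    sum≡sumOver : ∀ xs → sum xs ≡ ∑[ x ∈ xs ] x
    sum≡sumOver []       = refl
    sum≡sumOver (x ∷ xs) = cong (x +_) (sum≡sumOver xs)

  crt≤crossingsAgainst : ∀ fL fR → crt T ≤ crossingsAgainst fL (pos fR ∘ (σ ⟨$⟩ʳ_))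
  crt≤crossingsAgainst fL fR = subst (crt T ≤_) (crossings≡crossingsAgainst fL fR)
    (minimum-≤ (∈-map⁺ _ (∈-cartesianProduct⁺ (allFlips-complete fL) (allFlips-complete fR))))

  σ-injective : Injective _≡_ _≡_ (σ ⟨$⟩ʳ_)
  σ-injective {i} {j} σi≡σj = trans (sym (inverseˡ σ)) (trans (cong (σ ⟨$⟩ˡ_) σi≡σj) (inverseˡ σ))

crossingBound-arithmetic : ∀ n c d p → 2 ≤ n → n ≤ d + 1 → 2 * c + d ≤ p → 2 * p + n ≡ n * n →
                           4 * c + n ≤ n * (n ∸ 1)
crossingBound-arithmetic n c d p 2≤n n≤d+1 2c+d≤p 2p+n≡n² = begin
  4 * c + n            ≤⟨ +-monoʳ-≤ (4 * c) n≤2d ⟩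
  4 * c + 2 * d        ≡⟨ distrib c d ⟩
  2 * (2 * c + d)      ≤⟨ *-monoʳ-≤ 2 2c+d≤p ⟩
  2 * p                ≡⟨ m+n∸n≡m (2 * p) n ⟨
  2 * p + n ∸ n        ≡⟨ cong (_∸ n) 2p+n≡n² ⟩
  n * n ∸ n            ≡⟨ cong (n * n ∸_) (*-identityʳ n) ⟨
  n * n ∸ n * 1        ≡⟨ *-distribˡ-∸ n n 1 ⟨
  n * (n ∸ 1)          ∎
  where
  open ≤-Reasoning
  distrib : ∀ c d → 4 * c + 2 * d ≡ 2 * (2 * c + d)
  distrib = solve-∀
  n≤2d : n ≤ 2 * d
  n≤2d = ≤-trans n≤d+1 (subst (d + 1 ≤_) (cong (d +_) (sym (+-identityʳ d)))
                                         (+-monoʳ-≤ d (≤-pred (≤-trans 2≤n (≤-trans n≤d+1 (≤-reflexive (+-comm d 1)))))))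

mainTheorem5 : (n : ℕ) → 2 ≤ n → (T : Tanglegram n) → 4 * crt T + n ≤ n * (n ∸ 1)
mainTheorem5 n 2≤n T@(tanglegram L R σ)
  with ∃≥average (allFlips R) (λ fR → imbalance L (pos fR ∘ (σ ⟨$⟩ʳ_)) + 1) n
                 (∈-length (allFlips-complete (referenceLayout R)))
                 (average-imbalance+1≥k L R (σ ⟨$⟩ʳ_) (σ-injective T))
... | fR , n≤D+1 with greedyLayout L (pos fR ∘ (σ ⟨$⟩ʳ_))
... | fL , greedy = begin
  4 * crt T + n                 ≤⟨ +-monoˡ-≤ n (*-monoʳ-≤ 4 (crt≤crossingsAgainst T fL fR)) ⟩
  4 * crossingsAgainst fL q + n ≤⟨ crossingBound-arithmetic n (crossingsAgainst fL q) (imbalance L q) (#leafPairs L)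
                                                            2≤n n≤D+1 greedy (2*#leafPairs+k≡k*k L) ⟩
  n * (n ∸ 1)                   ∎
  where
  open ≤-Reasoning
  q : Fin n → ℕ
  q = pos fR ∘ (σ ⟨$⟩ʳ_)
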